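{- Let $n,\Delta,f,\lambda$ be nonnegative integers with $\lambda f\Delta\cdot 2^{f\Delta}\le n$. Then there exists an edge-colored directed graph $G$ on $\Theta(n)$ vertices, in which every color class has at most $\Delta$ edges, with a source vertex $s$, such that every $f$-CFT single-source $\lambda$-bounded flow preserver of $G$ with source $s$ has $\Omega(\lambda 2^{f\Delta} n)$ edges.
   Context: An edge-colored graph assigns each edge exactly one color (uncolored edges may be regarded as having a unique color used nowhere else), with no restrictions; a color class is the set of edges of one color. For a set $F$ of colors, $G-F$ denotes $G$ with all edges whose color is in $F$ deleted. A subgraph $H\subseteq G$ is an $f$-CFT single-source $\lambda$-bounded flow preserver of $G$ with source $s$ if for every set $F$ of at most $f$ colors and every vertex $t$, letting $\alpha$ be the maximum number of edge-disjoint $s\rightsquigarrow t$ paths in $G-F$: if $\alpha\le\lambda$ then $H-F$ contains $\alpha$ edge-disjoint $s\rightsquigarrow t$ paths, and if $\alpha>\lambda$ then $H-F$ contains at least $\lambda$ edge-disjoint $s\rightsquigarrow t$ paths. -}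

module Defs where

open import Data.Nat using (ℕ; _≤_; _^_; _*_)
open import Data.Fin using (Fin)
open import Data.Fin.Subset using (Subset) renaming (_∈_ to _∈ₛ_)
open import Data.List using (List; []; _∷_; map; length; filter; concat; allFin)
open import Data.List.Membership.Propositional using (_∈_)
open import Data.List.Relation.Unary.Unique.Propositional using (Unique)
open import Data.Vec using (Vec; lookup; toList)
open import Data.Product using (Σ; _×_)

open import Data.Nat using () renaming (_≟_ to _≟ℕ_)
open import Relation.Binary.PropositionalEquality using (_≡_; _≢_)
open import Relation.Nullary using (¬_)

record ColouredDigraph : Set where
  field
    V      : ℕ
    m      : ℕ
    tail   : Fin m → Fin V
    head   : Fin m → Fin V
    colour : Fin m → ℕ

module _ (G : ColouredDigraph) where
  open ColouredDigraph G

  IsSimple : Set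
  IsSimple = (∀ e → tail e ≢ head e)
           × (∀ e e′ → tail e ≡ tail e′ → head e ≡ head e′ → e ≡ e′)

  classSize : ℕ → ℕ
  classSize c = length (filter (λ e → colour e ≟ℕ c) (allFin m))

  ColourClassesBounded : ℕ → Set
  ColourClassesBounded Δ = ∀ c → classSize c ≤ Δ

  data Walk (P : Fin m → Set) : Fin V → Fin V → List (Fin m) → Set where
    []  : ∀ {v} → Walk P v v []
    _∷_ : ∀ {e v es} → P e → Walk P (head e) v es → Walk P (tail e) v (e ∷ es)

  Path : (Fin m → Set) → Fin V → Fin V → List (Fin m) → Set
  Path P u v es = Walk P u v es × Unique (u ∷ map head es)

  EdgeDisjointPaths : (Fin m → Set) → Fin V → Fin V → ℕ → Set
  EdgeDisjointPaths P u v k =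
    Σ (Vec (List (Fin m)) k) λ ps →
      (∀ i → Path P u v (lookup ps i)) × Unique (concat (toList ps))

  -- edges of G - F  (F a list of colours, read as a set)
  InGminus : List ℕ → Fin m → Set
  InGminus F e = ¬ (colour e ∈ F)

  InHminus : Subset m → List ℕ → Fin m → Set
  InHminus H F e = (e ∈ₛ H) × ¬ (colour e ∈ F)

  -- Stated as: for every k ≤ lam, whenever G - F has k edge-disjoint s⇝t paths,
  -- so does H - F (equivalent to the "α ≤ lam / α > lam" formulation).
  IsCFTFlowPreserver : ℕ → ℕ → Fin V → Subset m → Set
  IsCFTFlowPreserver f lam s H =
    ∀ (F : List ℕ) → length F ≤ f → ∀ (t : Fin V) → ∀ k → k ≤ lam →
      EdgeDisjointPaths (InGminus F) s t k → EdgeDisjointPaths (InHminus H F) s t k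

-- Let d = fΔ. The tree gadget T_d has 2^d leaves; each leaf ℓ labels d of its edges, one per level,
-- so that deleting them leaves ℓ as the only leaf reachable from the root, while the root-to-ℓ
-- branch avoids them. Hang λ copies of T_d below a source s and join every leaf of every copy to
-- each of n sinks; the d edges labelled by leaf ℓ in copy i get f colours, Δ edges each. With these
-- f colours failed there are still λ edge-disjoint s ⇝ t paths to every sink t, one through each
-- copy (through leaf ℓ in copy i). But λ edge-disjoint s ⇝ t paths use all λ edges out of s, and
-- the one entering copy i can only leave it through leaf ℓ. So every preserver contains all
-- λ 2^d n leaf-to-sink edges, while the graph has O(λ d 2^d + n) = O(n) vertices.

module Submission where

open import Defs
open import Data.Empty using (⊥; ⊥-elim)
open import Data.Unit using (⊤; tt)
open import Data.Nat using (ℕ; zero; suc; _+_; _*_; _^_; _≤_; _<_; z≤n; s≤s)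
open import Data.Nat using () renaming (_≟_ to _≟ℕ_)
open import Data.Nat.Properties
  using ( ≤-refl; ≤-reflexive; ≤-trans; <-trans; <-irrefl; 1+n≰n; ≤∧≢⇒<; <⇒≱; m≤m+n; m≤n+m; n≤1+n
        ; +-monoʳ-<; +-monoʳ-≤; +-monoˡ-≤; +-mono-≤; *-monoʳ-≤; *-monoˡ-≤; *-mono-≤
        ; *-identityʳ; *-identityˡ; *-assoc; m^n>0; module ≤-Reasoning)
open import Data.Nat.Tactic.RingSolver using (solve-∀)
open import Data.Fin as Fin
  using (Fin; zero; suc; toℕ; _↑ˡ_; punchOut; inject₁; fromℕ; opposite; combine; remQuot)
open import Data.Fin.Properties
  using ( +↔⊎; *↔×; 0↔⊥; 1↔⊤; any?; injective⇒≤; punchOut-injective; suc-injective; 0≢1+n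
        ; toℕ-injective; toℕ-inject₁; toℕ-fromℕ; toℕ<n; toℕ≤pred[n]; opposite-involutive
        ; remQuot-combine; combine-remQuot; combine-injectiveˡ; combine-injectiveʳ)
open import Data.Fin.Subset using (Subset; ∣_∣) renaming (_∈_ to _∈ₛ_)
open import Data.Fin.Subset.Properties using (drop-there)
open import Data.List as List using (List; []; _∷_; map; _++_; concat; length; filter; allFin)
open import Data.List.Properties using (length-map; length-tabulate; map-∘; map-cong)
open import Data.List.Membership.Propositional using (_∈_; _∉_)
open import Data.List.Membership.Propositional.Properties
  using (∈-map⁻; ∈-++⁻; ∈-++⁺ˡ; ∈-++⁺ʳ; ∈-lookup; ∈-tabulate⁺; ∈-tabulate⁻)
open import Data.List.Relation.Unary.All as All using (All; []; _∷_)
import Data.List.Relation.Unary.All.Properties as AllP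
open AllP using (all-filter)
open import Data.List.Relation.Unary.Any using (here; there)
open import Data.List.Relation.Unary.AllPairs using ([]; _∷_)
open import Data.List.Relation.Unary.Unique.Propositional using (Unique)
import Data.List.Relation.Unary.Unique.Propositional.Properties as Unique
open import Data.Vec using (Vec; []; _∷_; here; lookup; toList; tabulate)
open import Data.Vec.Properties using (lookup∘tabulate)
open import Data.Product as Prod using (Σ; ∃; ∃₂; _×_; _,_; proj₁; proj₂)
open import Data.Product.Function.NonDependent.Propositional using (_×-↔_)
open import Data.Maybe as Maybe using (Maybe; just; nothing)
open import Data.Maybe.Properties using (just-injective)
open import Data.Sum using (_⊎_; inj₁; inj₂)
open import Data.Sum.Properties using (inj₁-injective)
open import Data.Sum.Function.Propositional using (_⊎-↔_)
open import Function using (_∘_; _↔_; Inverse; Injective)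
open import Function.Bundles using (Injection)
open import Function.Properties.Inverse using (↔-refl; ↔-sym; ↔-trans; ↔⇒↣)
open import Relation.Nullary using (yes; no; contradiction)
open import Relation.Binary.PropositionalEquality

open Inverse using (to; from; strictlyInverseˡ; strictlyInverseʳ)

_⊎ᶠ_ : ∀ {A B : Set} {a b} → A ↔ Fin a → B ↔ Fin b → (A ⊎ B) ↔ Fin (a + b)
I ⊎ᶠ J = ↔-trans (I ⊎-↔ J) (↔-sym +↔⊎)

_×ᶠ_ : ∀ {A B : Set} {a b} → A ↔ Fin a → B ↔ Fin b → (A × B) ↔ Fin (a * b)
I ×ᶠ J = ↔-trans (I ×-↔ J) (↔-sym *↔×)

to-injective : ∀ {A B : Set} (I : A ↔ B) {x y} → to I x ≡ to I y → x ≡ y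
to-injective I = Injection.injective (↔⇒↣ I)

from-injective : ∀ {A B : Set} (I : A ↔ B) {x y} → from I x ≡ from I y → x ≡ y
from-injective I = to-injective (↔-sym I)

∈-map-from⁻ : ∀ {A B : Set} (I : A ↔ B) {x ys} → x ∈ map (from I) ys → to I x ∈ ys
∈-map-from⁻ I x∈ with ∈-map⁻ (from I) x∈
... | y , y∈ , refl = subst (_∈ _) (sym (strictlyInverseˡ I y)) y∈

lookup-injective : ∀ {A : Set} {xs : List A} → Unique xs →
                   ∀ {i j} → List.lookup xs i ≡ List.lookup xs j → i ≡ j
lookup-injective (_ ∷ _) {zero} {zero} _ = refl
lookup-injective (x∉ ∷ _) {zero} {suc j} eq = contradiction eq (All.lookup x∉ (∈-lookup j))
lookup-injective (x∉ ∷ _) {suc i} {zero} eq = contradiction (sym eq) (All.lookup x∉ (∈-lookup i))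
lookup-injective (_ ∷ u) {suc i} {suc j} eq = cong suc (lookup-injective u eq)

unique⇒length≤ : ∀ {n} {xs : List (Fin n)} → Unique xs → length xs ≤ n
unique⇒length≤ u = injective⇒≤ (lookup-injective u)

map⁺-on : ∀ {A B : Set} {P : A → Set} (g : A → B) → (∀ {x y} → P x → P y → g x ≡ g y → x ≡ y) →
          ∀ {xs} → All P xs → Unique xs → Unique (map g xs)
map⁺-on g inj [] [] = []
map⁺-on {P = P} g inj (px ∷ pxs) (x∉ ∷ u) = distinct pxs x∉ ∷ map⁺-on g inj pxs u
  where
  distinct : ∀ {ys} → All P ys → All (_ ≢_) ys → All (g _ ≢_) (map g ys)
  distinct [] [] = []
  distinct (py ∷ pys) (x≢y ∷ x≢ys) = (x≢y ∘ inj px py) ∷ distinct pys x≢ys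

++-disjoint : ∀ {A : Set} (xs : List A) {ys x} → Unique (xs ++ ys) → x ∈ xs → x ∉ ys
++-disjoint (_ ∷ xs) (x∉ ∷ _) (here refl) x∈ys = All.lookup x∉ (∈-++⁺ʳ xs x∈ys) refl
++-disjoint (_ ∷ xs) (_ ∷ u) (there x∈xs) = ++-disjoint xs u x∈xs

++-uniqueʳ : ∀ {A : Set} (xs : List A) {ys} → Unique (xs ++ ys) → Unique ys
++-uniqueʳ [] u = u
++-uniqueʳ (_ ∷ xs) (_ ∷ u) = ++-uniqueʳ xs u

∈-concat-lookup : ∀ {A : Set} {n} (ps : Vec (List A) n) j {x} → x ∈ lookup ps j → x ∈ concat (toList ps)
∈-concat-lookup (p ∷ ps) zero x∈ = ∈-++⁺ˡ x∈
∈-concat-lookup (p ∷ ps) (suc j) x∈ = ∈-++⁺ʳ p (∈-concat-lookup ps j x∈)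

∈-concat-tabulate⁻ : ∀ {A : Set} {n} (g : Fin n → List A) {x} →
                     x ∈ concat (toList (tabulate g)) → ∃ λ j → x ∈ g j
∈-concat-tabulate⁻ {n = suc n} g x∈ with ∈-++⁻ (g zero) x∈
... | inj₁ x∈g₀ = zero , x∈g₀
... | inj₂ x∈rest with ∈-concat-tabulate⁻ (g ∘ suc) x∈rest
... | j , x∈gj = suc j , x∈gj

concat-unique⇒lookup-disjoint : ∀ {A : Set} {n} (ps : Vec (List A) n) → Unique (concat (toList ps)) →
                                ∀ j j′ {x} → x ∈ lookup ps j → x ∈ lookup ps j′ → j ≡ j′
concat-unique⇒lookup-disjoint (p ∷ ps) u zero zero _ _ = refl
concat-unique⇒lookup-disjoint (p ∷ ps) u zero (suc j′) x∈ x∈′ =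
  ⊥-elim (++-disjoint p u x∈ (∈-concat-lookup ps j′ x∈′))
concat-unique⇒lookup-disjoint (p ∷ ps) u (suc j) zero x∈ x∈′ =
  ⊥-elim (++-disjoint p u x∈′ (∈-concat-lookup ps j x∈))
concat-unique⇒lookup-disjoint (p ∷ ps) u (suc j) (suc j′) x∈ x∈′ =
  cong suc (concat-unique⇒lookup-disjoint ps (++-uniqueʳ p u) j j′ x∈ x∈′)

concat-tabulate-unique : ∀ {A : Set} {n} (g : Fin n → List A) → (∀ j → Unique (g j)) →
                         (∀ j j′ {x} → x ∈ g j → x ∈ g j′ → j ≡ j′) →
                         Unique (concat (toList (tabulate g)))
concat-tabulate-unique {n = zero} g u sep = []
concat-tabulate-unique {n = suc n} g u sep =
  Unique.++⁺ (u zero)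
    (concat-tabulate-unique (g ∘ suc) (u ∘ suc) (λ j j′ x∈ x∈′ → suc-injective (sep _ _ x∈ x∈′)))
    λ (x∈g₀ , x∈rest) → let j , x∈gj = ∈-concat-tabulate⁻ (g ∘ suc) x∈rest in
      0≢1+n (sep zero (suc j) x∈g₀ x∈gj)

↑ˡ-⊆⇒≤∣∣ : ∀ k r (H : Subset (k + r)) → (∀ i → (i ↑ˡ r) ∈ₛ H) → k ≤ ∣ H ∣
↑ˡ-⊆⇒≤∣∣ zero r H _ = z≤n
↑ˡ-⊆⇒≤∣∣ (suc k) r (_ ∷ H) all∈ with all∈ zero
... | here = s≤s (↑ˡ-⊆⇒≤∣∣ k r H (drop-there ∘ all∈ ∘ suc))

injective⇒surjective : ∀ {n} {g : Fin n → Fin n} → Injective _≡_ _≡_ g → ∀ i → ∃ λ j → g j ≡ i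
injective⇒surjective {suc n} {g} g-inj i with any? (λ j → g j Fin.≟ i)
... | yes hit = hit
... | no miss = contradiction (injective⇒≤ punched-injective) 1+n≰n
  where
  missed : ∀ j → i ≢ g j
  missed j eq = miss (j , sym eq)
  punched : Fin (suc n) → Fin n
  punched j = punchOut (missed j)
  punched-injective : Injective _≡_ _≡_ punched
  punched-injective {j} {j′} eq = g-inj (punchOut-injective (missed j) (missed j′) eq)

data WalkBy {E X : Set} (tl hd : E → X) : X → X → List E → Set where
  ε   : ∀ {x} → WalkBy tl hd x x []
  _◅_ : ∀ e {b es} → WalkBy tl hd (hd e) b es → WalkBy tl hd (tl e) b (e ∷ es)

infixr 5 _◅_

module _ {E X : Set} {tl hd : E → X} where

  infixr 5 _◅◅_

  start-at : ∀ {a a′ b es} → a ≡ a′ → WalkBy tl hd a b es → WalkBy tl hd a′ b es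
  start-at refl w = w

  _◅◅_ : ∀ {a b c es es′} → WalkBy tl hd a b es → WalkBy tl hd b c es′ → WalkBy tl hd a c (es ++ es′)
  ε ◅◅ w′ = w′
  (e ◅ w) ◅◅ w′ = e ◅ (w ◅◅ w′)

  chain-walk : ∀ k (v : Fin (suc k) → X) (e : Fin k → E) →
               (∀ i → tl (e i) ≡ v (inject₁ i)) → (∀ i → hd (e i) ≡ v (suc i)) →
               WalkBy tl hd (v zero) (v (fromℕ k)) (List.tabulate e)
  chain-walk zero v e tl-e hd-e = ε
  chain-walk (suc k) v e tl-e hd-e =
    start-at (tl-e zero) (e zero ◅ start-at (sym (hd-e zero))
      (chain-walk k (v ∘ suc) (e ∘ suc) (tl-e ∘ suc) (hd-e ∘ suc)))

  ranked-walk-unique : (rank : X → ℕ) → (∀ e → rank (tl e) < rank (hd e)) →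
                       ∀ {a b es} → WalkBy tl hd a b es → Unique (a ∷ map hd es)
  ranked-walk-unique rank increasing = unique
    where
    above : ∀ {a b es} → WalkBy tl hd a b es → All (λ x → rank a < rank x) (map hd es)
    above ε = []
    above (e ◅ w) = increasing e ∷ All.map (<-trans (increasing e)) (above w)
    unique : ∀ {a b es} → WalkBy tl hd a b es → Unique (a ∷ map hd es)
    unique ε = [] ∷ []
    unique (e ◅ w) = All.map (λ lt eq → <-irrefl (cong rank eq) lt) (above (e ◅ w)) ∷ unique w

module _ {E X E′ X′ : Set} {tl hd : E → X} {tl′ hd′ : E′ → X′} (φ : X → X′) (ψ : E → E′)
         (tl-ψ : ∀ e → tl′ (ψ e) ≡ φ (tl e)) (hd-ψ : ∀ e → hd′ (ψ e) ≡ φ (hd e)) where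

  map-walk : ∀ {a b es} → WalkBy tl hd a b es → WalkBy tl′ hd′ (φ a) (φ b) (map ψ es)
  map-walk ε = ε
  map-walk (e ◅ w) =
    start-at (tl-ψ e) (ψ e ◅ start-at (sym (hd-ψ e)) (map-walk w))

module Enumerated {E X : Set} {m V : ℕ} (tl hd : E → X) (colourOf : E → ℕ)
                  (edges : E ↔ Fin m) (vertices : X ↔ Fin V) where

  graph : ColouredDigraph
  graph = record
    { V = V ; m = m
    ; tail = to vertices ∘ tl ∘ from edges
    ; head = to vertices ∘ hd ∘ from edges
    ; colour = colourOf ∘ from edges
    }

  private
    walk-from : ∀ {P a a′ b ks} → a ≡ a′ → Walk graph P a b ks → Walk graph P a′ b ks
    walk-from refl w = w

  tail-to : ∀ e → ColouredDigraph.tail graph (to edges e) ≡ to vertices (tl e)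
  tail-to e = cong (to vertices ∘ tl) (strictlyInverseʳ edges e)

  head-to : ∀ e → ColouredDigraph.head graph (to edges e) ≡ to vertices (hd e)
  head-to e = cong (to vertices ∘ hd) (strictlyInverseʳ edges e)

  colour-to : ∀ e → ColouredDigraph.colour graph (to edges e) ≡ colourOf e
  colour-to e = cong colourOf (strictlyInverseʳ edges e)

  lift-walk : ∀ {P a b es} → WalkBy tl hd a b es → All (P ∘ to edges) es →
              Walk graph P (to vertices a) (to vertices b) (map (to edges) es)
  lift-walk ε [] = []
  lift-walk (e ◅ w) (p ∷ ps) = walk-from (tail-to e) (p ∷ walk-from (sym (head-to e)) (lift-walk w ps))

  lift-path : ∀ {P a b es} → WalkBy tl hd a b es → All (P ∘ to edges) es → Unique (a ∷ map hd es) →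
              Path graph P (to vertices a) (to vertices b) (map (to edges) es)
  lift-path {es = es} w ps u = lift-walk w ps , subst (λ xs → Unique (_ ∷ xs)) heads
    (Unique.map⁺ (to-injective vertices) u)
    where
    heads : map (to vertices) (map hd es) ≡ map (ColouredDigraph.head graph) (map (to edges) es)
    heads = trans (sym (map-∘ es)) (trans (map-cong (sym ∘ head-to) es) (map-∘ es))

  private
    lower : ∀ {P u v ks} → Walk graph P u v ks →
            WalkBy tl hd (from vertices u) (from vertices v) (map (from edges) ks) ×
            All (P ∘ to edges) (map (from edges) ks)
    lower [] = ε , []
    lower {P} (_∷_ {e = k} p w) with lower w
    ... | w′ , ps =
      start-at (sym (strictlyInverseʳ vertices _)) (from edges k ◅ start-at (strictlyInverseʳ vertices _) w′) ,
      subst P (sym (strictlyInverseˡ edges k)) p ∷ ps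

  lower-walk : ∀ {P a b ks} → Walk graph P (to vertices a) (to vertices b) ks →
               WalkBy tl hd a b (map (from edges) ks) × All (P ∘ to edges) (map (from edges) ks)
  lower-walk {a = a} {b} w with lower w
  ... | w′ , ps =
    subst₂ (λ x z → WalkBy tl hd x z _) (strictlyInverseʳ vertices a) (strictlyInverseʳ vertices b) w′ , ps

-- T₍ₕ₊₁₎ has a root and, for each side b, a spine of 2ʰ + 1 vertices
-- entered from the root and leading into a copy of Tₕ; leaf (combine b y) of T₍ₕ₊₁₎ is leaf y of
-- copy b. Labels are (leaf, level) pairs: the i-th spine edge on side b is labelled by leaf i of
-- the other copy at level 0, and inside copy b the labels of Tₕ are kept, moved to copy b and
-- raised by one level.

Vertex : ℕ → Set
Vertex zero    = ⊤
Vertex (suc h) = ⊤ ⊎ (Fin 2 × (Fin (suc (2 ^ h)) ⊎ Vertex h))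

pattern root      = inj₁ tt
pattern spine b p = inj₂ (b , inj₁ p)
pattern below b v = inj₂ (b , inj₂ v)

Edge : ℕ → Set
Edge zero    = ⊥
Edge (suc h) = Fin 2 × (⊤ ⊎ (Fin (2 ^ h) ⊎ (⊤ ⊎ Edge h)))

pattern descend b  = b , inj₁ tt
pattern step b i   = b , inj₂ (inj₁ i)
pattern enter b    = b , inj₂ (inj₂ (inj₁ tt))
pattern inside b e = b , inj₂ (inj₂ (inj₂ e))

side : ∀ h → Fin (2 ^ suc h) → Fin 2
side h x = proj₁ (remQuot {2} (2 ^ h) x)

position : ∀ h → Fin (2 ^ suc h) → Fin (2 ^ h)
position h x = proj₂ (remQuot {2} (2 ^ h) x)

combine-side-position : ∀ h x → combine (side h x) (position h x) ≡ x
combine-side-position h = combine-remQuot {2} (2 ^ h)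

rootVertex : ∀ h → Vertex h
rootVertex zero    = tt
rootVertex (suc h) = root

tailE headE : ∀ {h} → Edge h → Vertex h
tailE {suc h} (descend b)  = root
tailE {suc h} (step b i)   = spine b (inject₁ i)
tailE {suc h} (enter b)    = spine b (fromℕ (2 ^ h))
tailE {suc h} (inside b e) = below b (tailE e)
headE {suc h} (descend b)  = spine b zero
headE {suc h} (step b i)   = spine b (suc i)
headE {suc h} (enter b)    = below b (rootVertex h)
headE {suc h} (inside b e) = below b (headE e)

leafVertex : ∀ h → Fin (2 ^ h) → Vertex h
leafVertex zero    _ = tt
leafVertex (suc h) x = below (side h x) (leafVertex h (position h x))

label : ∀ {h} → Edge h → Maybe (Fin (2 ^ h) × Fin h)
label {suc h} (descend b)  = nothing
label {suc h} (step b i)   = just (combine (opposite b) i , zero)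
label {suc h} (enter b)    = nothing
label {suc h} (inside b e) = Maybe.map (Prod.map (combine b) suc) (label e)

Unlabelled : ∀ {h} → Fin (2 ^ h) → Edge h → Set
Unlabelled ℓ e = ∀ l → label e ≢ just (ℓ , l)

branch : ∀ h → Fin (2 ^ h) → List (Edge h)
branchVia : ∀ h → Fin 2 → Fin (2 ^ h) → List (Edge (suc h))
branch zero    _ = []
branch (suc h) x = branchVia h (side h x) (position h x)
branchVia h b y =
  descend b ∷ List.tabulate (λ i → step b i) ++ enter b ∷ map (λ e → inside b e) (branch h y)

-- The vertices reachable from the root of Tₕ along edges not labelled ℓ.
data Reach : ∀ h → Fin (2 ^ h) → Vertex h → Set where
  at-bottom      : ∀ {ℓ} → Reach zero ℓ tt
  at-root        : ∀ {h ℓ} → Reach (suc h) ℓ root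
  on-own-spine   : ∀ {h b} {y : Fin (2 ^ h)} {p} → Reach (suc h) (combine b y) (spine b p)
  on-other-spine : ∀ {h b} {y : Fin (2 ^ h)} {p} → toℕ p ≤ toℕ y →
                   Reach (suc h) (combine b y) (spine (opposite b) p)
  in-subtree     : ∀ {h} {b : Fin 2} {y v} → Reach h y v → Reach (suc h) (combine b y) (below b v)

opposite≢ : ∀ (b : Fin 2) → opposite b ≢ b
opposite≢ zero ()
opposite≢ (suc zero) ()

unlabelled-inside⁺ : ∀ {h} {b : Fin 2} {y} {e : Edge h} →
                     Unlabelled y e → Unlabelled (combine b y) (inside b e)
unlabelled-inside⁺ {b = b} {y} {e} unl l eq with label e
... | just (x , l′) =
  unl l′ (cong (λ z → just (z , l′)) (combine-injectiveʳ b x b y (cong proj₁ (just-injective eq))))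

unlabelled-inside⁻ : ∀ {h} {b : Fin 2} {y} {e : Edge h} →
                     Unlabelled (combine b y) (inside b e) → Unlabelled y e
unlabelled-inside⁻ unl l eq = unl (suc l) (cong (Maybe.map _) eq)

reach-root : ∀ h ℓ → Reach h ℓ (rootVertex h)
reach-root zero    ℓ = at-bottom
reach-root (suc h) ℓ = at-root

data LeafView h : Fin (2 ^ suc h) → Set where
  leafAt : ∀ (b : Fin 2) (y : Fin (2 ^ h)) → LeafView h (combine b y)

leafView : ∀ h ℓ → LeafView h ℓ
leafView h ℓ = subst (LeafView h) (combine-side-position h ℓ) (leafAt (side h ℓ) (position h ℓ))

reach-spine-start : ∀ {h} ℓ b′ → Reach (suc h) ℓ (spine b′ zero)
reach-spine-start {h} ℓ b′ with leafView h ℓ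
reach-spine-start _ zero       | leafAt zero       _ = on-own-spine
reach-spine-start _ (suc zero) | leafAt zero       _ = on-other-spine {b = zero} z≤n
reach-spine-start _ zero       | leafAt (suc zero) _ = on-other-spine {b = suc zero} z≤n
reach-spine-start _ (suc zero) | leafAt (suc zero) _ = on-own-spine

reach-step : ∀ {h ℓ} (e : Edge h) → Reach h ℓ (tailE e) → Unlabelled ℓ e → Reach h ℓ (headE e)
reach-step {suc h} {ℓ} (descend b′) at-root _ = reach-spine-start ℓ b′
reach-step {suc h} (step b i) on-own-spine _ = on-own-spine
reach-step {suc h} (step _ i) (on-other-spine {b = b} {y} i≤y) unl =
  on-other-spine {b = b} (≤∧≢⇒< i≤y′ i≢y)
  where
  i≤y′ : toℕ i ≤ toℕ y
  i≤y′ = subst (_≤ toℕ y) (toℕ-inject₁ i) i≤y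
  i≢y : toℕ i ≢ toℕ y
  i≢y eq = unl zero (trans (cong (λ c → just (combine c i , zero)) (opposite-involutive b))
                            (cong (λ z → just (combine b z , zero)) (toℕ-injective eq)))
reach-step {suc h} (enter b) (on-own-spine {y = y}) _ = in-subtree {b = b} (reach-root h y)
reach-step {suc h} (enter _) (on-other-spine {y = y} top≤y) _ =
  ⊥-elim (<⇒≱ (toℕ<n y) (subst (_≤ toℕ y) (toℕ-fromℕ (2 ^ h)) top≤y))
reach-step {suc h} (inside b e) (in-subtree r) unl =
  in-subtree {b = b} (reach-step e r (unlabelled-inside⁻ {b = b} unl))

reach-walk : ∀ {h ℓ a b es} → WalkBy tailE headE a b es → All (Unlabelled ℓ) es →
             Reach h ℓ a → Reach h ℓ b
reach-walk ε [] r = r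
reach-walk (e ◅ w) (unl ∷ unls) r = reach-walk w unls (reach-step e r unl)

reach-leaf : ∀ h {ℓ} x → Reach h ℓ (leafVertex h x) → x ≡ ℓ
reach-leaf zero    {zero} zero _ = refl
reach-leaf (suc h) x (in-subtree r) =
  trans (sym (combine-side-position h x)) (cong (combine (side h x)) (reach-leaf h _ r))

branch-walk : ∀ h x → WalkBy tailE headE (rootVertex h) (leafVertex h x) (branch h x)
branch-walk zero    x = ε
branch-walk (suc h) x =
  descend b ◅ chain-walk (2 ^ h) (λ p → spine b p) (λ i → step b i) (λ _ → refl) (λ _ → refl) ◅◅
  enter b ◅ map-walk (λ v → below b v) (λ e → inside b e) (λ _ → refl) (λ _ → refl)
                     (branch-walk h (position h x))
  where
  b : Fin 2
  b = side h x

branch-unlabelled : ∀ h x → All (Unlabelled x) (branch h x)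
branch-unlabelled zero    x = []
branch-unlabelled (suc h) x =
  subst (λ ℓ → All (Unlabelled ℓ) (branch (suc h) x)) (combine-side-position h x)
        (via (side h x) (position h x))
  where
  spine-unlabelled : ∀ b y i → Unlabelled (combine b y) (step b i)
  spine-unlabelled b y i l eq =
    opposite≢ b (combine-injectiveˡ (opposite b) i b y (cong proj₁ (just-injective eq)))
  via : ∀ b y → All (Unlabelled (combine b y)) (branchVia h b y)
  via b y = (λ _ ()) ∷ AllP.++⁺ (AllP.tabulate⁺ (spine-unlabelled b y))
                       ((λ _ ()) ∷ AllP.map⁺ (All.map (unlabelled-inside⁺ {b = b}) (branch-unlabelled h y)))

reach-own-leaf : ∀ h x → Reach h x (leafVertex h x)
reach-own-leaf h x = reach-walk (branch-walk h x) (branch-unlabelled h x) (reach-root h x)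

leafVertex-injective : ∀ h {x x′} → leafVertex h x ≡ leafVertex h x′ → x ≡ x′
leafVertex-injective h {x} {x′} eq = reach-leaf h x (subst (Reach h x′) (sym eq) (reach-own-leaf h x′))

depth : ∀ {h} → Vertex h → ℕ
depth {zero}  _           = 0
depth {suc h} root        = 0
depth {suc h} (spine b p) = suc (toℕ p)
depth {suc h} (below b v) = 2 + 2 ^ h + depth v

height : ℕ → ℕ
height zero    = 0
height (suc h) = 2 + 2 ^ h + height h

depth-increasing : ∀ {h} (e : Edge h) → depth (tailE e) < depth (headE e)
depth-increasing {suc h} (descend b)  = s≤s z≤n
depth-increasing {suc h} (step b i)   = s≤s (s≤s (≤-reflexive (toℕ-inject₁ i)))
depth-increasing {suc h} (enter b)    =
  ≤-trans (s≤s (s≤s (≤-reflexive (toℕ-fromℕ (2 ^ h))))) (m≤m+n (2 + 2 ^ h) _)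
depth-increasing {suc h} (inside b e) = +-monoʳ-< (2 + 2 ^ h) (depth-increasing e)

depth≤height : ∀ {h} (v : Vertex h) → depth v ≤ height h
depth≤height {zero}  _           = z≤n
depth≤height {suc h} root        = z≤n
depth≤height {suc h} (spine b p) =
  s≤s (≤-trans (toℕ≤pred[n] p) (≤-trans (m≤m+n (2 ^ h) (height h)) (n≤1+n _)))
depth≤height {suc h} (below b v) = +-monoʳ-≤ (2 + 2 ^ h) (depth≤height v)

parent : ∀ {h} → Vertex h → Maybe (Edge h)
parent {zero}  _                 = nothing
parent {suc h} root              = nothing
parent {suc h} (spine b zero)    = just (descend b)
parent {suc h} (spine b (suc i)) = just (step b i)
parent {suc h} (below b v)       = just (Maybe.maybe (λ e → inside b e) (enter b) (parent v))

parent-root : ∀ h → parent (rootVertex h) ≡ nothing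
parent-root zero    = refl
parent-root (suc h) = refl

parent-head : ∀ {h} (e : Edge h) → parent (headE e) ≡ just e
parent-head {suc h} (descend b)  = refl
parent-head {suc h} (step b i)   = refl
parent-head {suc h} (enter b)    rewrite parent-root h = refl
parent-head {suc h} (inside b e) rewrite parent-head e = refl

headE-injective : ∀ {h} {e e′ : Edge h} → headE e ≡ headE e′ → e ≡ e′
headE-injective {e = e} {e′} eq =
  just-injective (trans (sym (parent-head e)) (trans (cong parent eq) (parent-head e′)))

headE≢root : ∀ {h} (e : Edge h) → headE e ≢ rootVertex h
headE≢root {h} e eq with () ← trans (sym (parent-head e)) (trans (cong parent eq) (parent-root h))

labelled : ∀ h → Fin (2 ^ h) × Fin h → Edge h
labelled (suc h) (x , zero)  = step (opposite (side h x)) (position h x)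
labelled (suc h) (x , suc l) = inside (side h x) (labelled h (position h x , l))

labelled-label : ∀ {h} (e : Edge h) {p} → label e ≡ just p → labelled h p ≡ e
labelled-label {suc h} (step b i) refl =
  trans (cong (λ q → step (opposite (proj₁ q)) (proj₂ q)) (remQuot-combine (opposite b) i))
        (cong (λ c → step c i) (opposite-involutive b))
labelled-label {suc h} (inside b e) eq with label e in le
... | just (x , l) with refl ← eq =
  trans (cong (λ q → inside (proj₁ q) (labelled h (proj₂ q , l))) (remQuot-combine b x))
        (cong (λ e′ → inside b e′) (labelled-label e le))

vertexCount : ℕ → ℕ
vertexCount zero    = 1
vertexCount (suc h) = 1 + 2 * (suc (2 ^ h) + vertexCount h)

edgeCount : ℕ → ℕ
edgeCount zero    = 0
edgeCount (suc h) = 2 * (1 + (2 ^ h + (1 + edgeCount h)))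

vertexEnum : ∀ h → Vertex h ↔ Fin (vertexCount h)
vertexEnum zero    = ↔-sym 1↔⊤
vertexEnum (suc h) = ↔-sym 1↔⊤ ⊎ᶠ (↔-refl ×ᶠ (↔-refl ⊎ᶠ vertexEnum h))

edgeEnum : ∀ h → Edge h ↔ Fin (edgeCount h)
edgeEnum zero    = ↔-sym 0↔⊥
edgeEnum (suc h) = ↔-refl ×ᶠ (↔-sym 1↔⊤ ⊎ᶠ (↔-refl ⊎ᶠ (↔-sym 1↔⊤ ⊎ᶠ edgeEnum h)))

vertexCount-bound : ∀ h → vertexCount h + 3 ≤ 4 * (suc h * 2 ^ h)
vertexCount-bound zero    = ≤-refl
vertexCount-bound (suc h) = begin
  vertexCount (suc h) + 3                        ≡⟨ unfold (2 ^ h) (vertexCount h) ⟩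
  2 * 2 ^ h + 2 * (vertexCount h + 3)            ≤⟨ +-monoʳ-≤ (2 * 2 ^ h) (*-monoʳ-≤ 2 (vertexCount-bound h)) ⟩
  2 * 2 ^ h + 2 * (4 * (suc h * 2 ^ h))          ≤⟨ m≤m+n _ (6 * 2 ^ h) ⟩
  2 * 2 ^ h + 2 * (4 * (suc h * 2 ^ h)) + 6 * 2 ^ h ≡⟨ fold (2 ^ h) h ⟩
  4 * (suc (suc h) * 2 ^ suc h)                  ∎
  where
  open ≤-Reasoning
  unfold : ∀ p t → 1 + 2 * (suc p + t) + 3 ≡ 2 * p + 2 * (t + 3)
  unfold = solve-∀
  fold : ∀ p h → 2 * p + 2 * (4 * (suc h * p)) + 6 * p ≡ 4 * (suc (suc h) * (2 * p))
  fold = solve-∀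

classSize≤ : ∀ (G : ColouredDigraph) {Δ c} (slot : Fin (ColouredDigraph.m G) → Fin Δ) →
             (∀ {e e′} → ColouredDigraph.colour G e ≡ c → ColouredDigraph.colour G e′ ≡ c →
                         slot e ≡ slot e′ → e ≡ e′) →
             classSize G c ≤ Δ
classSize≤ G {Δ} {c} slot slot-injective =
  subst (_≤ Δ) (length-map slot members)
    (unique⇒length≤ (map⁺-on slot slot-injective (all-filter _ (allFin m))
                                                   (Unique.filter⁺ _ (Unique.allFin⁺ m))))
  where
  open ColouredDigraph G
  members : List (Fin m)
  members = filter (λ e → colour e ≟ℕ c) (allFin m)

module Construction (lam f Δ n : ℕ) (Δ>0 : 0 < Δ) where

  d : ℕ
  d = f * Δ

  GVertex : Set
  GVertex = ⊤ ⊎ ((Fin lam × Vertex d) ⊎ Fin n)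

  pattern source         = inj₁ tt
  pattern treeVertex i v = inj₂ (inj₁ (i , v))
  pattern sink y         = inj₂ (inj₂ y)

  GEdge : Set
  GEdge = ((Fin lam × Fin (2 ^ d)) × Fin n) ⊎ (Fin lam ⊎ (Fin lam × Edge d))

  pattern leafEdge i x y = inj₁ ((i , x) , y)
  pattern rootEdge i     = inj₂ (inj₁ i)
  pattern treeEdge i e   = inj₂ (inj₂ (i , e))

  gtail ghead : GEdge → GVertex
  gtail (leafEdge i x y) = treeVertex i (leafVertex d x)
  gtail (rootEdge i)     = source
  gtail (treeEdge i e)   = treeVertex i (tailE e)
  ghead (leafEdge i x y) = sink y
  ghead (rootEdge i)     = treeVertex i (rootVertex d)
  ghead (treeEdge i e)   = treeVertex i (headE e)

  treeVertex-injective : ∀ {i i′ v v′} → _≡_ {A = GVertex} (treeVertex i v) (treeVertex i′ v′) →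
                         i ≡ i′ × v ≡ v′
  treeVertex-injective refl = refl , refl

  leafEdgeCount otherEdgeCount : ℕ
  leafEdgeCount  = lam * 2 ^ d * n
  otherEdgeCount = lam + lam * edgeCount d

  leafEdgeEnum : ((Fin lam × Fin (2 ^ d)) × Fin n) ↔ Fin leafEdgeCount
  leafEdgeEnum = (↔-refl ×ᶠ ↔-refl) ×ᶠ ↔-refl

  gedgeEnum : GEdge ↔ Fin (leafEdgeCount + otherEdgeCount)
  gedgeEnum = leafEdgeEnum ⊎ᶠ (↔-refl ⊎ᶠ (↔-refl ×ᶠ edgeEnum d))

  gvertexEnum : GVertex ↔ Fin (1 + (lam * vertexCount d + n))
  gvertexEnum = ↔-sym 1↔⊤ ⊎ᶠ ((↔-refl ×ᶠ vertexEnum d) ⊎ᶠ ↔-refl)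

  glabel : GEdge → Maybe (Fin lam × Fin (2 ^ d) × Fin d)
  glabel (treeEdge i e)   = Maybe.map (i ,_) (label e)
  glabel (leafEdge _ _ _) = nothing
  glabel (rootEdge _)     = nothing

  -- A labelled tree edge is coloured by (tree, leaf, block of its level), the d = fΔ levels
  -- being cut into f blocks of Δ; every other edge has a colour of its own.
  ColourKey : Set
  ColourKey = (Fin lam × Fin (2 ^ d) × Fin f) ⊎ GEdge

  keyEnum : ColourKey ↔ Fin (lam * (2 ^ d * f) + (leafEdgeCount + otherEdgeCount))
  keyEnum = (↔-refl ×ᶠ (↔-refl ×ᶠ ↔-refl)) ⊎ᶠ gedgeEnum

  block : Fin d → Fin f
  block l = proj₁ (remQuot {f} Δ l)

  offset : Fin d → Fin Δ
  offset l = proj₂ (remQuot {f} Δ l)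

  keyOf : GEdge → Maybe (Fin lam × Fin (2 ^ d) × Fin d) → ColourKey
  keyOf e nothing            = inj₂ e
  keyOf e (just (i , x , l)) = inj₁ (i , x , block l)

  colourOf : GEdge → ℕ
  colourOf e = toℕ (to keyEnum (keyOf e (glabel e)))

  open Enumerated gtail ghead colourOf gedgeEnum gvertexEnum public
    renaming (graph to G)

  -- The slot of an unlabelled edge is arbitrary: it is alone in its colour class.
  slotOf : Maybe (Fin lam × Fin (2 ^ d) × Fin d) → Fin Δ
  slotOf nothing             = Fin.fromℕ< Δ>0
  slotOf (just (_ , _ , l)) = offset l

  glabelled : Fin lam × Fin (2 ^ d) × Fin d → GEdge
  glabelled (i , x , l) = treeEdge i (labelled d (x , l))

  glabelled-glabel : ∀ e {p} → glabel e ≡ just p → glabelled p ≡ e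
  glabelled-glabel (treeEdge i a) eq with label a in la
  ... | just q with refl ← eq = cong (λ a′ → treeEdge i a′) (labelled-label a la)

  block-offset-injective : ∀ {l l′} → block l ≡ block l′ → offset l ≡ offset l′ → l ≡ l′
  block-offset-injective {l} {l′} b≡ o≡ =
    trans (sym (combine-remQuot {f} Δ l)) (trans (cong₂ combine b≡ o≡) (combine-remQuot {f} Δ l′))

  key-slot-injective : ∀ e e′ → keyOf e (glabel e) ≡ keyOf e′ (glabel e′) →
                       slotOf (glabel e) ≡ slotOf (glabel e′) → e ≡ e′
  key-slot-injective e e′ k s with glabel e in le | glabel e′ in le′
  ... | nothing | nothing with refl ← k = refl
  ... | just (i , x , l) | just (i′ , x′ , l′) =
    trans (sym (glabelled-glabel e le)) (trans (cong glabelled same) (glabelled-glabel e′ le′))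
    where
    k′ : (i , x , block l) ≡ (i′ , x′ , block l′)
    k′ = inj₁-injective k
    same : (i , x , l) ≡ (i′ , x′ , l′)
    same = cong₂ _,_ (cong proj₁ k′) (cong₂ _,_ (cong (proj₁ ∘ proj₂) k′)
                                       (block-offset-injective (cong (proj₂ ∘ proj₂) k′) s))

  failures : Fin lam → Fin (2 ^ d) → List ℕ
  failures i ℓ = List.tabulate (λ b → toℕ (to keyEnum (inj₁ (i , ℓ , b))))

  FreeOf : Fin lam → Fin (2 ^ d) → GEdge → Set
  FreeOf i ℓ e = ∀ l → glabel e ≢ just (i , ℓ , l)

  free⇒colour∉failures : ∀ {i ℓ e} → FreeOf i ℓ e → colourOf e ∉ failures i ℓ
  free⇒colour∉failures {i} {ℓ} {e} free c∈ with ∈-tabulate⁻ c∈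
  ... | b , eq
    with glabel e | to-injective keyEnum {keyOf e (glabel e)} {inj₁ (i , ℓ , b)} (toℕ-injective eq)
  ... | just (_ , _ , l) | refl = free l refl

  colour∉failures⇒free : ∀ {i ℓ e} → colourOf e ∉ failures i ℓ → FreeOf i ℓ e
  colour∉failures⇒free {i} {ℓ} {e} c∉ l le =
    c∉ (subst (λ m → toℕ (to keyEnum (keyOf e m)) ∈ failures i ℓ) (sym le) (∈-tabulate⁺ (block l)))

  unlabelled⇒free : ∀ {i j ℓ e} → Unlabelled ℓ e → FreeOf i ℓ (treeEdge j e)
  unlabelled⇒free {e = e} unl l eq with label e
  ... | just _ with refl ← eq = unl l refl

  free⇒unlabelled : ∀ {i ℓ e} → FreeOf i ℓ (treeEdge i e) → Unlabelled ℓ e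
  free⇒unlabelled {i} free l eq = free l (cong (Maybe.map (i ,_)) eq)

  rank : GVertex → ℕ
  rank source           = 0
  rank (treeVertex _ v) = suc (depth v)
  rank (sink _)         = 2 + height d

  rank-increasing : ∀ e → rank (gtail e) < rank (ghead e)
  rank-increasing (leafEdge _ x _) = s≤s (s≤s (depth≤height (leafVertex d x)))
  rank-increasing (rootEdge _)     = s≤s z≤n
  rank-increasing (treeEdge _ e)   = s≤s (depth-increasing e)

  parallel : ∀ e e′ → gtail e ≡ gtail e′ → ghead e ≡ ghead e′ → e ≡ e′
  parallel (leafEdge i x y) (leafEdge _ _ _) t refl with treeVertex-injective t
  ... | refl , leaves = cong (λ x′ → leafEdge i x′ y) (leafVertex-injective d leaves)
  parallel (leafEdge _ _ _) (rootEdge _)     _ ()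
  parallel (leafEdge _ _ _) (treeEdge _ _)   _ ()
  parallel (rootEdge _)     (leafEdge _ _ _) _ ()
  parallel (treeEdge _ _)   (leafEdge _ _ _) _ ()
  parallel (rootEdge _)     (rootEdge _)     _ h = cong (λ j → rootEdge j) (proj₁ (treeVertex-injective h))
  parallel (rootEdge _)     (treeEdge _ e′)  _ h =
    ⊥-elim (headE≢root e′ (sym (proj₂ (treeVertex-injective h))))
  parallel (treeEdge _ e)   (rootEdge _)     _ h =
    ⊥-elim (headE≢root e (proj₂ (treeVertex-injective h)))
  parallel (treeEdge i _)   (treeEdge _ _)   _ h with treeVertex-injective h
  ... | refl , heads = cong (λ e → treeEdge i e) (headE-injective heads)

  simple : IsSimple G
  simple = no-loop , no-parallel
    where
    no-loop : ∀ k → ColouredDigraph.tail G k ≢ ColouredDigraph.head G k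
    no-loop k eq =
      <-irrefl (cong rank (to-injective gvertexEnum {gtail (from gedgeEnum k)} {ghead (from gedgeEnum k)} eq))
               (rank-increasing (from gedgeEnum k))
    no-parallel : ∀ k k′ → ColouredDigraph.tail G k ≡ ColouredDigraph.tail G k′ →
                  ColouredDigraph.head G k ≡ ColouredDigraph.head G k′ → k ≡ k′
    no-parallel k k′ t h = from-injective gedgeEnum
      (parallel _ _ (to-injective gvertexEnum {gtail (from gedgeEnum k)} {gtail (from gedgeEnum k′)} t)
                    (to-injective gvertexEnum {ghead (from gedgeEnum k)} {ghead (from gedgeEnum k′)} h))

  colour-classes : ColourClassesBounded G Δ
  colour-classes c = classSize≤ G (slotOf ∘ glabel ∘ from gedgeEnum) λ p p′ s →
    from-injective gedgeEnum (key-slot-injective _ _ (to-injective keyEnum (toℕ-injective (trans p (sym p′)))) s)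

  module AtLeafEdge (i : Fin lam) (ℓ : Fin (2 ^ d)) (y : Fin n) where

    route : Fin lam → List GEdge
    route j = rootEdge j ∷ map (λ e → treeEdge j e) (branch d ℓ) ++ leafEdge j ℓ y ∷ []

    route-walk : ∀ j → WalkBy gtail ghead source (sink y) (route j)
    route-walk j =
      rootEdge j ◅
      map-walk (λ v → treeVertex j v) (λ e → treeEdge j e) (λ _ → refl) (λ _ → refl) (branch-walk d ℓ) ◅◅
      leafEdge j ℓ y ◅ ε

    route-free : ∀ j → All (FreeOf i ℓ) (route j)
    route-free j =
      (λ _ ()) ∷ AllP.++⁺ (AllP.map⁺ (All.map unlabelled⇒free (branch-unlabelled d ℓ))) ((λ _ ()) ∷ [])

    treeOf : GEdge → Fin lam
    treeOf (leafEdge j _ _) = j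
    treeOf (rootEdge j)     = j
    treeOf (treeEdge j _)   = j

    route-in-tree : ∀ j → All (λ e → treeOf e ≡ j) (route j)
    route-in-tree j = refl ∷ AllP.++⁺ (AllP.map⁺ (All.universal (λ _ → refl) _)) (refl ∷ [])

    flows : EdgeDisjointPaths G (InGminus G (failures i ℓ))
                              (to gvertexEnum source) (to gvertexEnum (sink y)) lam
    flows = tabulate path , paths , concat-tabulate-unique path edges-unique separated
      where
      path : Fin lam → List (Fin (leafEdgeCount + otherEdgeCount))
      path j = map (to gedgeEnum) (route j)
      avoids : ∀ j → All (InGminus G (failures i ℓ) ∘ to gedgeEnum) (route j)
      avoids j = All.map (λ {e} free → subst (_∉ failures i ℓ) (sym (colour-to e))
                                                (free⇒colour∉failures {e = e} free))
                         (route-free j)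
      route-unique : ∀ j → Unique (source ∷ map ghead (route j))
      route-unique j = ranked-walk-unique rank rank-increasing (route-walk j)
      paths : ∀ j → Path G (InGminus G (failures i ℓ)) (to gvertexEnum source) (to gvertexEnum (sink y))
                           (lookup (tabulate path) j)
      paths j = subst (Path G _ _ _) (sym (lookup∘tabulate path j))
                      (lift-path (route-walk j) (avoids j) (route-unique j))
      edges-unique : ∀ j → Unique (path j)
      edges-unique j with route-unique j
      ... | _ ∷ heads = Unique.map⁺ (to-injective gedgeEnum) (Unique.map⁻ {f = ghead} {xs = route j} heads)
      separated : ∀ j j′ {k} → k ∈ path j → k ∈ path j′ → j ≡ j′
      separated j j′ k∈ k∈′ with ∈-map⁻ (to gedgeEnum) k∈ | ∈-map⁻ (to gedgeEnum) k∈′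
      ... | e , e∈ , refl | e′ , e∈′ , eq =
        trans (sym (All.lookup (route-in-tree j) e∈))
              (trans (cong treeOf (to-injective gedgeEnum {e} {e′} eq)) (All.lookup (route-in-tree j′) e∈′))

    starts-at-root : ∀ {a es} → WalkBy gtail ghead a (sink y) es → a ≡ source →
                     ∃₂ λ j es′ → es ≡ rootEdge j ∷ es′ ×
                                  WalkBy gtail ghead (treeVertex j (rootVertex d)) (sink y) es′
    starts-at-root (rootEdge j ◅ w)     _  = j , _ , refl , w
    starts-at-root ε                    ()
    starts-at-root (leafEdge _ _ _ ◅ _) ()
    starts-at-root (treeEdge _ _ ◅ _)   ()

    stuck-at-sink : ∀ {a b es y′} → WalkBy gtail ghead a b es → a ≡ sink y′ → b ≡ a
    stuck-at-sink ε                    _  = refl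
    stuck-at-sink (leafEdge _ _ _ ◅ _) ()
    stuck-at-sink (rootEdge _ ◅ _)     ()
    stuck-at-sink (treeEdge _ _ ◅ _)   ()

    escape : ∀ {a v es} → WalkBy gtail ghead a (sink y) es → a ≡ treeVertex i v → Reach d ℓ v →
             All (FreeOf i ℓ) es → leafEdge i ℓ y ∈ es
    escape ε                  () _ _
    escape (rootEdge _ ◅ _)   () _ _
    escape (treeEdge _ e ◅ w) eq r (free ∷ frees) with treeVertex-injective eq
    ... | refl , refl = there (escape w refl (reach-step e r (free⇒unlabelled free)) frees)
    escape (leafEdge _ x _ ◅ w) eq r _ with treeVertex-injective eq
    ... | refl , refl with refl ← reach-leaf d x r | refl ← stuck-at-sink w refl = here refl

    entry : ∀ {es} → WalkBy gtail ghead source (sink y) es → Fin lam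
    entry w = proj₁ (starts-at-root w refl)

    entry-∈ : ∀ {es} (w : WalkBy gtail ghead source (sink y) es) → rootEdge (entry w) ∈ es
    entry-∈ w with starts-at-root w refl
    ... | _ , _ , refl , _ = here refl

    entry-escape : ∀ {es} (w : WalkBy gtail ghead source (sink y) es) → All (FreeOf i ℓ) es →
                   entry w ≡ i → leafEdge i ℓ y ∈ es
    entry-escape w frees eq with starts-at-root w refl
    entry-escape w (_ ∷ frees) refl | _ , _ , refl , w′ = there (escape w′ refl (reach-root d ℓ) frees)

    -- The λ disjoint paths leave the source through λ distinct root edges, so one enters tree i.
    forced-leaf : ∀ {H} → EdgeDisjointPaths G (InHminus G H (failures i ℓ))
                                            (to gvertexEnum source) (to gvertexEnum (sink y)) lam →
                  to gedgeEnum (leafEdge i ℓ y) ∈ₛ H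
    forced-leaf {H} (ps , paths , disjoint) =
      proj₁ (All.lookup (avoided j) (entry-escape (walk j) (frees j) j↦i))
      where
      walk : ∀ j → WalkBy gtail ghead source (sink y) (map (from gedgeEnum) (lookup ps j))
      walk j = proj₁ (lower-walk {a = source} {sink y} (proj₁ (paths j)))
      avoided : ∀ j → All (InHminus G H (failures i ℓ) ∘ to gedgeEnum) (map (from gedgeEnum) (lookup ps j))
      avoided j = proj₂ (lower-walk {a = source} {sink y} (proj₁ (paths j)))
      frees : ∀ j → All (FreeOf i ℓ) (map (from gedgeEnum) (lookup ps j))
      frees j = All.map (λ {e} p → colour∉failures⇒free {e = e}
                                     (subst (_∉ failures i ℓ) (colour-to e) (proj₂ p)))
                        (avoided j)
      root∈ : ∀ j → to gedgeEnum (rootEdge (entry (walk j))) ∈ lookup ps j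
      root∈ j = ∈-map-from⁻ gedgeEnum (entry-∈ (walk j))
      entry-injective : Injective _≡_ _≡_ (entry ∘ walk)
      entry-injective {j} {j′} eq = concat-unique⇒lookup-disjoint ps disjoint j j′ (root∈ j)
        (subst (λ r → to gedgeEnum (rootEdge r) ∈ lookup ps j′) (sym eq) (root∈ j′))
      hit : ∃ λ j → entry (walk j) ≡ i
      hit = injective⇒surjective entry-injective i
      j : Fin lam
      j = proj₁ hit
      j↦i : entry (walk j) ≡ i
      j↦i = proj₂ hit

  preserver-contains-leafEdges : ∀ H → IsCFTFlowPreserver G f lam (to gvertexEnum source) H →
                                 ∀ i ℓ y → to gedgeEnum (leafEdge i ℓ y) ∈ₛ H
  preserver-contains-leafEdges H preserves i ℓ y = AtLeafEdge.forced-leaf i ℓ y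
    (preserves (failures i ℓ) (≤-reflexive (length-tabulate _)) (to gvertexEnum (sink y)) lam ≤-refl
               (AtLeafEdge.flows i ℓ y))

  preserver-size : ∀ H → IsCFTFlowPreserver G f lam (to gvertexEnum source) H → lam * 2 ^ d * n ≤ ∣ H ∣
  preserver-size H preserves = ↑ˡ-⊆⇒≤∣∣ leafEdgeCount otherEdgeCount H λ k →
    subst (λ k′ → (k′ ↑ˡ otherEdgeCount) ∈ₛ H) (strictlyInverseˡ leafEdgeEnum k)
      (preserver-contains-leafEdges H preserves _ _ _)

vertex-bound : ∀ {lam h n} → 1 ≤ lam → 1 ≤ h → lam * h * 2 ^ h ≤ n →
               1 + (lam * vertexCount h + n) ≤ 10 * n
vertex-bound {lam} {h} {n} 1≤lam 1≤h small = begin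
  1 + (lam * vertexCount h + n) ≤⟨ +-mono-≤ 1≤n (+-monoˡ-≤ n trees≤8n) ⟩
  n + (8 * n + n)               ≡⟨ total n ⟩
  10 * n                        ∎
  where
  open ≤-Reasoning
  total : ∀ m → m + (8 * m + m) ≡ 10 * m
  total = solve-∀
  expand : ∀ l k p → l * (4 * (suc k * p)) ≡ 4 * (l * k * p) + 4 * (l * p)
  expand = solve-∀
  double : ∀ m → 4 * m + 4 * m ≡ 8 * m
  double = solve-∀
  lp≤X : lam * 2 ^ h ≤ lam * h * 2 ^ h
  lp≤X = *-monoˡ-≤ (2 ^ h) (≤-trans (≤-reflexive (sym (*-identityʳ lam))) (*-monoʳ-≤ lam 1≤h))
  1≤n : 1 ≤ n
  1≤n = ≤-trans (*-mono-≤ 1≤lam (m^n>0 2 h)) (≤-trans lp≤X small)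
  trees≤8n : lam * vertexCount h ≤ 8 * n
  trees≤8n = begin
    lam * vertexCount h                        ≤⟨ *-monoʳ-≤ lam (≤-trans (m≤m+n _ 3) (vertexCount-bound h)) ⟩
    lam * (4 * (suc h * 2 ^ h))                ≡⟨ expand lam h (2 ^ h) ⟩
    4 * (lam * h * 2 ^ h) + 4 * (lam * 2 ^ h)  ≤⟨ +-monoʳ-≤ (4 * (lam * h * 2 ^ h)) (*-monoʳ-≤ 4 lp≤X) ⟩
    4 * (lam * h * 2 ^ h) + 4 * (lam * h * 2 ^ h) ≤⟨ +-mono-≤ (*-monoʳ-≤ 4 small) (*-monoʳ-≤ 4 small) ⟩
    4 * n + 4 * n                              ≡⟨ double n ⟩
    8 * n                                      ∎

theoremA3 : Σ ℕ λ A → Σ ℕ λ B → Σ ℕ λ C →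
    ∀ (n Δ f lam : ℕ) → 1 ≤ f → 1 ≤ Δ → 1 ≤ lam →
      lam * f * Δ * 2 ^ (f * Δ) ≤ n →
      Σ ColouredDigraph λ G →
        IsSimple G × ColourClassesBounded G Δ ×
        (n ≤ A * ColouredDigraph.V G) × (ColouredDigraph.V G ≤ B * n) ×
        Σ (Fin (ColouredDigraph.V G)) λ s →
          ∀ (H : Subset (ColouredDigraph.m G)) → IsCFTFlowPreserver G f lam s H →
            lam * 2 ^ (f * Δ) * n ≤ C * ∣ H ∣
theoremA3 = 1 , 10 , 1 , λ n Δ f lam 1≤f 1≤Δ 1≤lam small →
  let open Construction lam f Δ n 1≤Δ in
  G , simple , colour-classes ,
  ≤-trans (≤-trans (m≤n+m n _) (n≤1+n _)) (≤-reflexive (sym (*-identityˡ _))) ,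
  vertex-bound 1≤lam (*-mono-≤ 1≤f 1≤Δ) (subst (λ k → k * 2 ^ (f * Δ) ≤ n) (*-assoc lam f Δ) small) ,
  to gvertexEnum source ,
  λ H preserves → ≤-trans (preserver-size H preserves) (≤-reflexive (sym (*-identityˡ _)))
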